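{- Let $\mathbb{C}$ be any comonad on $\mathcal{R}(\sigma)$ or on $\mathcal{R}_*(\sigma)$. For structures $A_1,A_2,B_1,B_2$, if $A_1\cong_{\mathbb{C}}B_1$ and $A_2\cong_{\mathbb{C}}B_2$, then $A_1\times A_2\cong_{\mathbb{C}}B_1\times B_2$.
   Context: $\mathcal{R}(\sigma)$: category of $\sigma$-structures and homomorphisms; $\mathcal{R}_*(\sigma)$: pointed $\sigma$-structures. $A\times B$ is the categorical product (componentwise relations; pair of points in the pointed case). $A\cong_{\mathbb{C}}B$ means $A$ and $B$ are isomorphic in the Kleisli category of $\mathbb{C}$, whose morphisms $A\to B$ are homomorphisms $\mathbb{C}(A)\to B$, with identities the counit $\varepsilon_A$ and composition $g\bullet f=g\circ\mathbb{C}(f)\circ\delta_A$. -}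

module Defs where

open import Data.Nat using (ℕ)
open import Data.Fin using (Fin)
open import Data.Bool using (Bool; true; false)
open import Data.Unit using (⊤; tt)
open import Data.Product using (_×_; _,_; proj₁; proj₂)
open import Function using (_∘_; id)
open import Relation.Binary.PropositionalEquality using (_≡_)

record Signature : Set₁ where
  field
    Sym   : Set
    arity : Sym → ℕ
open Signature public

-- The mode selects the category: false = 𝓡(σ), true = 𝓡_*(σ) (pointed).
Point : Bool → Set → Set
Point false X = ⊤
Point true  X = X

record Str (σ : Signature) (pt : Bool) : Set₁ where
  field
    Carrier : Set
    rel     : (R : Sym σ) → (Fin (arity σ R) → Carrier) → Set
    point   : Point pt Carrier
open Str public

PreservesPoint : ∀ pt {X Y : Set} → Point pt X → Point pt Y → (X → Y) → Set
PreservesPoint false _ _ f = ⊤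
PreservesPoint true  x y f = f x ≡ y

record Hom {σ : Signature} {pt : Bool} (A B : Str σ pt) : Set where
  field
    fun    : Carrier A → Carrier B
    presR  : ∀ (R : Sym σ) (t : Fin (arity σ R) → Carrier A) → rel A R t → rel B R (fun ∘ t)
    presPt : PreservesPoint pt (point A) (point B) fun
open Hom public

_≈_ : ∀ {σ pt} {A B : Str σ pt} → Hom A B → Hom A B → Set
f ≈ g = ∀ x → fun f x ≡ fun g x

idH : ∀ {σ pt} (A : Str σ pt) → Hom A A
idH {pt = false} A = record { fun = id ; presR = λ R t r → r ; presPt = tt }
idH {pt = true}  A = record { fun = id ; presR = λ R t r → r ; presPt = Relation.Binary.PropositionalEquality.refl }

PreservesPoint-∘ : ∀ pt {X Y Z : Set} (x : Point pt X) (y : Point pt Y) (z : Point pt Z)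
  (g : Y → Z) (f : X → Y) → PreservesPoint pt y z g → PreservesPoint pt x y f
  → PreservesPoint pt x z (g ∘ f)
PreservesPoint-∘ false x y z g f p q = tt
PreservesPoint-∘ true  x y z g f p q =
  Relation.Binary.PropositionalEquality.trans (Relation.Binary.PropositionalEquality.cong g q) p

_∘H_ : ∀ {σ pt} {A B C : Str σ pt} → Hom B C → Hom A B → Hom A C
_∘H_ {pt = pt} {A} {B} {C} g f = record
  { fun = fun g ∘ fun f
  ; presR = λ R t r → presR g R (fun f ∘ t) (presR f R t r)
  ; presPt = PreservesPoint-∘ pt (point A) (point B) (point C) (fun g) (fun f) (presPt g) (presPt f) }

pairPt : ∀ pt {X Y : Set} → Point pt X → Point pt Y → Point pt (X × Y)
pairPt false _ _ = tt
pairPt true  x y = x , y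

_×S_ : ∀ {σ pt} → Str σ pt → Str σ pt → Str σ pt
_×S_ {pt = pt} A B = record
  { Carrier = Carrier A × Carrier B
  ; rel     = λ R t → rel A R (proj₁ ∘ t) × rel B R (proj₂ ∘ t)
  ; point   = pairPt pt (point A) (point B) }

record Comonad (σ : Signature) (pt : Bool) : Set₁ where
  field
    F       : Str σ pt → Str σ pt
    fmap    : ∀ {A B} → Hom A B → Hom (F A) (F B)
    fmap-≈  : ∀ {A B} {f g : Hom A B} → f ≈ g → fmap f ≈ fmap g
    fmap-id : ∀ {A} → fmap (idH A) ≈ idH (F A)
    fmap-∘  : ∀ {A B C} (g : Hom B C) (f : Hom A B) → fmap (g ∘H f) ≈ (fmap g ∘H fmap f)
    ε       : ∀ A → Hom (F A) A
    δ       : ∀ A → Hom (F A) (F (F A))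
    ε-nat   : ∀ {A B} (f : Hom A B) → (f ∘H ε A) ≈ (ε B ∘H fmap f)
    δ-nat   : ∀ {A B} (f : Hom A B) → (fmap (fmap f) ∘H δ A) ≈ (δ B ∘H fmap f)
    εδ      : ∀ A → (ε (F A) ∘H δ A) ≈ idH (F A)
    Fεδ     : ∀ A → (fmap (ε A) ∘H δ A) ≈ idH (F A)
    δδ      : ∀ A → (δ (F A) ∘H δ A) ≈ (fmap (δ A) ∘H δ A)
open Comonad public

KHom : ∀ {σ pt} (C : Comonad σ pt) → Str σ pt → Str σ pt → Set
KHom C A B = Hom (F C A) B

kcomp : ∀ {σ pt} (C : Comonad σ pt) {A B D : Str σ pt} → KHom C B D → KHom C A B → KHom C A D
kcomp C {A} g f = g ∘H (fmap C f ∘H δ C A)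

-- A ≅_ℂ B : isomorphism in the Kleisli category (identities are the counits).
record KIso {σ pt} (C : Comonad σ pt) (A B : Str σ pt) : Set where
  field
    to       : KHom C A B
    from     : KHom C B A
    from-to  : kcomp C from to ≈ ε C A
    to-from  : kcomp C to from ≈ ε C B

{-# OPTIONS --safe #-}
-- Kleisli morphisms combine componentwise as f₁ ⊗ f₂ = ⟨f₁ ∘ ℂπ₁ , f₂ ∘ ℂπ₂⟩,
-- so each projection satisfies πᵢ ∘ (f₁ ⊗ f₂) = fᵢ ∘ ℂπᵢ.  By naturality of δ
-- such squares survive Kleisli composition, and by naturality of ε
--   πᵢ ∘ ((g₁ ⊗ g₂) • (f₁ ⊗ f₂)) = (gᵢ • fᵢ) ∘ ℂπᵢ = εᵢ ∘ ℂπᵢ = πᵢ ∘ ε,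
-- so ⊗ carries pairs of Kleisli inverses to Kleisli inverses.
module Submission where

open import Defs
open import Data.Bool using (Bool; true; false)
open import Data.Unit using (tt)
open import Function using (_∘_)
open import Data.Product using (_,_; proj₁; proj₂)
open import Relation.Binary.PropositionalEquality using (_≡_; refl; sym; cong; cong₂; module ≡-Reasoning)

proj₁-preservesPoint : ∀ pt {X Y : Set} (x : Point pt X) (y : Point pt Y)
  → PreservesPoint pt (pairPt pt x y) x proj₁
proj₁-preservesPoint false x y = tt
proj₁-preservesPoint true  x y = refl

proj₂-preservesPoint : ∀ pt {X Y : Set} (x : Point pt X) (y : Point pt Y)
  → PreservesPoint pt (pairPt pt x y) y proj₂
proj₂-preservesPoint false x y = tt
proj₂-preservesPoint true  x y = refl

pair-preservesPoint : ∀ pt {Z X Y : Set} (z : Point pt Z) (x : Point pt X) (y : Point pt Y)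
  (f : Z → X) (g : Z → Y) → PreservesPoint pt z x f → PreservesPoint pt z y g
  → PreservesPoint pt z (pairPt pt x y) (λ w → f w , g w)
pair-preservesPoint false _ _ _ _ _ _ _ = tt
pair-preservesPoint true  _ _ _ _ _ p q = cong₂ _,_ p q

module _ {σ : Signature} {pt : Bool} where

  π₁H : (A B : Str σ pt) → Hom (A ×S B) A
  π₁H A B = record
    { fun = proj₁ ; presR = λ R t r → proj₁ r ; presPt = proj₁-preservesPoint pt (point A) (point B) }

  π₂H : (A B : Str σ pt) → Hom (A ×S B) B
  π₂H A B = record
    { fun = proj₂ ; presR = λ R t r → proj₂ r ; presPt = proj₂-preservesPoint pt (point A) (point B) }

  ⟨_,_⟩H : {X A B : Str σ pt} → Hom X A → Hom X B → Hom X (A ×S B)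
  ⟨_,_⟩H {X} {A} {B} f g = record
    { fun = λ x → fun f x , fun g x
    ; presR = λ R t r → presR f R t r , presR g R t r
    ; presPt = pair-preservesPoint pt (point X) (point A) (point B) (fun f) (fun g) (presPt f) (presPt g) }

  module _ (C : Comonad σ pt) where

    kcomp-natural : {A A′ B B′ D D′ : Str σ pt}
      (f : KHom C A B) (g : KHom C B D) (f′ : KHom C A′ B′) (g′ : KHom C B′ D′)
      (r : Hom A A′) (q : Hom B B′) (p : Hom D D′)
      → (p ∘H g) ≈ (g′ ∘H fmap C q) → (q ∘H f) ≈ (f′ ∘H fmap C r)
      → (p ∘H kcomp C g f) ≈ (kcomp C g′ f′ ∘H fmap C r)
    kcomp-natural {A} f g f′ g′ r q p pg qf x = begin
      fun p (fun g (fun (fmap C f) y))             ≡⟨ pg _ ⟩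
      fun g′ (fun (fmap C q) (fun (fmap C f) y))   ≡⟨ cong (fun g′) (sym (fmap-∘ C q f y)) ⟩
      fun g′ (fun (fmap C (q ∘H f)) y)             ≡⟨ cong (fun g′) (fmap-≈ C qf y) ⟩
      fun g′ (fun (fmap C (f′ ∘H fmap C r)) y)     ≡⟨ cong (fun g′) (fmap-∘ C f′ (fmap C r) y) ⟩
      fun g′ (fun (fmap C f′) (fun (fmap C (fmap C r)) y)) ≡⟨ cong (fun g′ ∘ fun (fmap C f′)) (δ-nat C r x) ⟩
      fun (kcomp C g′ f′) (fun (fmap C r) x)       ∎
      where
      open ≡-Reasoning
      y = fun (δ C A) x

    kcomp-inverse-natural : {A A′ B B′ : Str σ pt}
      (F : KHom C A B) (G : KHom C B A) (f : KHom C A′ B′) (g : KHom C B′ A′)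
      (p : Hom A A′) (q : Hom B B′)
      → (p ∘H G) ≈ (g ∘H fmap C q) → (q ∘H F) ≈ (f ∘H fmap C p)
      → kcomp C g f ≈ ε C A′
      → (p ∘H kcomp C G F) ≈ (p ∘H ε C A)
    kcomp-inverse-natural F G f g p q pG qF gf x = begin
      fun p (fun (kcomp C G F) x)            ≡⟨ kcomp-natural F G f g p q p pG qF x ⟩
      fun (kcomp C g f) (fun (fmap C p) x)   ≡⟨ gf _ ⟩
      fun (ε C _) (fun (fmap C p) x)         ≡⟨ sym (ε-nat C p x) ⟩
      fun p (fun (ε C _) x)                  ∎
      where open ≡-Reasoning

    _⊗_ : {A₁ A₂ B₁ B₂ : Str σ pt}
      → KHom C A₁ B₁ → KHom C A₂ B₂ → KHom C (A₁ ×S A₂) (B₁ ×S B₂)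
    _⊗_ {A₁} {A₂} f₁ f₂ = ⟨ f₁ ∘H fmap C (π₁H A₁ A₂) , f₂ ∘H fmap C (π₂H A₁ A₂) ⟩H

    ⊗-inverse : {A₁ A₂ B₁ B₂ : Str σ pt}
      (f₁ : KHom C A₁ B₁) (g₁ : KHom C B₁ A₁) (f₂ : KHom C A₂ B₂) (g₂ : KHom C B₂ A₂)
      → kcomp C g₁ f₁ ≈ ε C A₁ → kcomp C g₂ f₂ ≈ ε C A₂
      → kcomp C (g₁ ⊗ g₂) (f₁ ⊗ f₂) ≈ ε C (A₁ ×S A₂)
    ⊗-inverse {A₁} {A₂} {B₁} {B₂} f₁ g₁ f₂ g₂ e₁ e₂ x = cong₂ _,_
      (kcomp-inverse-natural (f₁ ⊗ f₂) (g₁ ⊗ g₂) f₁ g₁ (π₁H A₁ A₂) (π₁H B₁ B₂)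
        (λ _ → refl) (λ _ → refl) e₁ x)
      (kcomp-inverse-natural (f₁ ⊗ f₂) (g₁ ⊗ g₂) f₂ g₂ (π₂H A₁ A₂) (π₂H B₁ B₂)
        (λ _ → refl) (λ _ → refl) e₂ x)

proposition6 : (σ : Signature) (pt : Bool) (C : Comonad σ pt)
    (A₁ A₂ B₁ B₂ : Str σ pt)
    → KIso C A₁ B₁ → KIso C A₂ B₂ → KIso C (A₁ ×S A₂) (B₁ ×S B₂)
proposition6 σ pt C A₁ A₂ B₁ B₂ i₁ i₂ = record
  { to      = _⊗_ C (to i₁) (to i₂)
  ; from    = _⊗_ C (from i₁) (from i₂)
  ; from-to = ⊗-inverse C (to i₁) (from i₁) (to i₂) (from i₂) (from-to i₁) (from-to i₂)
  ; to-from = ⊗-inverse C (from i₁) (to i₁) (from i₂) (to i₂) (to-from i₁) (to-from i₂)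
  }
  where open KIso
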